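{- Let $\mathbb{A}$ be a partial combinatory algebra with elementary subalgebra $\mathbb{A}'\subseteq\mathbb{A}$, and let $\mathsf{RT}(\mathbb{A},\mathbb{A}')$ be the relative realizability topos. Every Lawvere–Tierney topology on $\mathsf{RT}(\mathbb{A},\mathbb{A}')$ is represented by a map $\mathcal{P}(\mathbb{A})\to\mathcal{P}(\mathbb{A})$ of the form $O_P$ for some partitioned assembly $(X,\rho_X)$ and predicate $P : X\to\mathcal{P}(\mathbb{A})$; equivalently, it is represented by a map of the form $O_f$ for some extended Weihrauch predicate $f:\mathbb{A}\to\mathcal{P}(\mathcal{P}(\mathbb{A}))$.
   Context: Lawvere–Tierney topologies on $\mathsf{RT}(\mathbb{A},\mathbb{A}')$ are represented, as usual in realizability, by maps $J:\mathcal{P}(\mathbb{A})\to\mathcal{P}(\mathbb{A})$ on realizability truth values. Write $c\cdot d$ for application in $\mathbb{A}$, $(c\cdot d)\downarrow$ for "is defined", $\langle\cdot,\cdot\rangle$ for the standard pairing, $\langle x,y,z\rangle := \langle x,\langle y,z\rangle\rangle$, and $\overline{0},\overline{1}$ for the standard numerals. A partitioned assembly $(X,\rho_X)$ is a set $X$ with a map $\rho_X : X\to\mathbb{A}$; a predicate on it is a map $P : X\to\mathcal{P}(\mathbb{A})$. For such $P$ and $S\in\mathcal{P}(\mathbb{A})$, $O_P\,S$ is the least subset of $\mathbb{A}$ satisfying $O_P\,S = \{\langle\overline{0},a\rangle \mid a\in S\}\cup\bigcup_{x\in X}\{\langle\overline{1},\langle\rho_X\,x, c\rangle\rangle\mid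 c\in\mathbb{A},\ \forall d\in P\,x.\,((c\cdot d)\downarrow \wedge c\cdot d\in O_P\,S)\}$. An extended Weihrauch predicate is a map $f:\mathbb{A}\to\mathcal{P}(\mathcal{P}(\mathbb{A}))$; for $S\in\mathcal{P}(\mathbb{A})$, $O_f\,S$ is the least subset satisfying $O_f\,S = \{\langle\overline{0},a\rangle\mid a\in S\}\cup\bigcup_{b\in\mathbb{A}}\bigcup_{\theta\in f\,b}\{\langle\overline{1},b,c\rangle\mid c\in\mathbb{A},\ \forall d\in\theta.\,((c\cdot d)\downarrow\wedge c\cdot d\in O_f\,S)\}$. -}

module Defs where

open import Level using (Level; _⊔_) renaming (suc to lsuc; zero to lzero)
open import Data.Product using (Σ; ∃; _×_; _,_)
open import Function.Bundles using (_⇔_)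
open import Relation.Binary.PropositionalEquality using (_≡_)

-- Application is a partial operation, given by its graph  a · b ↝ c
-- ("a·b is defined and equals c"), which is required to be functional.
-- The combinators k, s come with (Skolemised) names for the
-- always-defined partial applications k·a, s·a, s·a·b.

record PCA : Set₁ where
  infix 5 _·_↝_
  field
    A       : Set
    _·_↝_   : A → A → A → Set
    ·-func  : ∀ {a b c c′} → a · b ↝ c → a · b ↝ c′ → c ≡ c′
    k s     : A
    k₁      : A → A
    s₁      : A → A
    s₂      : A → A → A
    k-ax₁   : ∀ a → k · a ↝ k₁ a
    k-ax₂   : ∀ a b → k₁ a · b ↝ a
    s-ax₁   : ∀ a → s · a ↝ s₁ a
    s-ax₂   : ∀ a b → s₁ a · b ↝ s₂ a b
    s-ax₃   : ∀ a b c d →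
              (s₂ a b · c ↝ d) ⇔ (Σ A λ u → Σ A λ v → (a · c ↝ u) × (b · c ↝ v) × (u · v ↝ d))

record ElemSub (𝔸 : PCA) : Set₁ where
  open PCA 𝔸
  field
    A′      : A → Set
    k∈      : A′ k
    s∈      : A′ s
    ·-clos  : ∀ {a b c} → A′ a → A′ b → a · b ↝ c → A′ c

module _ (𝔸 : PCA) where
  open PCA 𝔸

  Pow : Set₁
  Pow = A → Set

  EWeihrauch : Set₁
  EWeihrauch = A → Pow → Set

  _·_∈_ : ∀ {ℓ} → A → A → (A → Set ℓ) → Set ℓ
  a · b ∈ Q = Σ A λ c → (a · b ↝ c) × Q c

  -- standard combinators, pairing and numerals (van Oosten):
  --   i = s k k,  ⟨a,b⟩ = λz. z a b = s(s i (k a))(k b),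
  --   0̄ = i,  (n+1)‾ = ⟨k i , n̄⟩
  i : A
  i = s₂ k k

  pair : A → A → A
  pair a b = s₂ (s₂ i (k₁ a)) (k₁ b)

  triple : A → A → A → A
  triple x y z = pair x (pair y z)

  n0 : A
  n0 = i

  n1 : A
  n1 = pair (k₁ i) n0

  data O-PA (X : Set₁) (ρ : X → A) (P : X → Pow) (S : Pow) : A → Set₁ where
    ret  : ∀ {a} → S a → O-PA X ρ P S (pair n0 a)
    ask  : (x : X) (c : A) →
           (∀ d → P x d → c · d ∈ O-PA X ρ P S) →
           O-PA X ρ P S (pair n1 (pair (ρ x) c))

  data O-EW (f : EWeihrauch) (S : Pow) : A → Set₁ where
    ret  : ∀ {a} → S a → O-EW f S (pair n0 a)
    ask  : (b : A) (θ : Pow) → f b θ → (c : A) →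
           (∀ d → θ d → c · d ∈ O-EW f S) →
           O-EW f S (triple n1 b c)

module _ (𝔸 : PCA) (𝔸′ : ElemSub 𝔸) where
  open PCA 𝔸
  open ElemSub 𝔸′

  _⇒_ : Pow 𝔸 → Pow 𝔸 → Pow 𝔸
  (p ⇒ q) c = ∀ a → p a → _·_∈_ 𝔸 c a q

  -- J : 𝒫(𝔸) → 𝒫(𝔸) represents a Lawvere–Tierney topology on RT(𝔸,𝔸′):
  -- it is a nucleus on the realizability tripos, i.e. with realizers in 𝔸′
  --   ⊢ ∀p. p → J p,   ⊢ ∀p. J(J p) → J p,   ⊢ ∀p q. (p → q) → (J p → J q).
  record IsTopology (J : Pow 𝔸 → Pow 𝔸) : Set₁ where
    field
      unit   : Σ A λ r → A′ r × (∀ p a → p a → _·_∈_ 𝔸 r a (J p))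
      mult   : Σ A λ r → A′ r × (∀ p a → J (J p) a → _·_∈_ 𝔸 r a (J p))
      mono   : Σ A λ r → A′ r × (∀ p q c → (p ⇒ q) c → _·_∈_ 𝔸 r c (J p ⇒ J q))

  -- Two maps on truth values are equivalent (represent the same
  -- topology) iff ⊢ ∀S. J S ↔ K S, with realizers in 𝔸′.
  _≃ᴶ_ : ∀ {ℓ ℓ′} → (Pow 𝔸 → A → Set ℓ) → (Pow 𝔸 → A → Set ℓ′) → Set (lsuc lzero ⊔ ℓ ⊔ ℓ′)
  J ≃ᴶ K = (Σ A λ r → A′ r × (∀ S a → J S a → _·_∈_ 𝔸 r a (K S)))
         × (Σ A λ r → A′ r × (∀ S a → K S a → _·_∈_ 𝔸 r a (J S)))

-- Take the partitioned assembly of all pairs (a , p) with a ∈ J p, realized by a and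
-- carrying the predicate p, so that O S consists of well-founded dialogues asking such
-- questions and ending in an element of S. An a ∈ J S is the one-question dialogue
-- ⟨1, ⟨a, λd.⟨0,d⟩⟩⟩. Conversely a dialogue is evaluated by a recursive realizer: an
-- answer ⟨0, a⟩ is sent into J S by the unit, and a question ⟨1, ⟨a, c⟩⟩ with a ∈ J p
-- by applying the monotonicity realizer, at the recursive evaluation of c, to a and
-- flattening J (J S) with the multiplication. The extended Weihrauch form is the same
-- data read as f b θ := J θ b.
module Submission where

open import Defs
open import Data.Nat using (ℕ; suc)
open import Data.Fin using (Fin; zero; suc; #_)
open import Data.Vec using (Vec; []; _∷_; lookup)
open import Data.Product using (Σ; _×_; _,_; proj₁; proj₂; map₁; map₂)
open import Function.Bundles using (Equivalence)

module Combinators (𝔸 : PCA) where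
  open PCA 𝔸

  s₂-· : ∀ {a b c u v d} → a · c ↝ u → b · c ↝ v → u · v ↝ d → s₂ a b · c ↝ d
  s₂-· {a} {b} {c} {u} {v} {d} ac↝u bc↝v uv↝d =
    Equivalence.from (s-ax₃ a b c d) (u , v , ac↝u , bc↝v , uv↝d)

  i-· : ∀ a → i 𝔸 · a ↝ a
  i-· a = s₂-· (k-ax₁ a) (k-ax₁ a) (k-ax₂ a (k₁ a))

  pair-· : ∀ {a b z f v} → z · a ↝ f → f · b ↝ v → pair 𝔸 a b · z ↝ v
  pair-· {a} {b} {z} za↝f fb↝v = s₂-· (s₂-· (i-· z) (k-ax₂ a z) za↝f) (k-ax₂ b z) fb↝v

  pair-·-k : ∀ a b → pair 𝔸 a b · k ↝ a
  pair-·-k a b = pair-· (k-ax₁ a) (k-ax₂ a b)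

  pair-·-k₁i : ∀ a b → pair 𝔸 a b · k₁ (i 𝔸) ↝ b
  pair-·-k₁i a b = pair-· (k-ax₂ (i 𝔸) a) (i-· b)

module Terms (𝔸 : PCA) (𝔸′ : ElemSub 𝔸) where
  open PCA 𝔸
  open ElemSub 𝔸′
  open Combinators 𝔸

  infixl 7 _∙_
  data Tm (n : ℕ) : Set where
    var : Fin n → Tm n
    con : (a : A) → A′ a → Tm n
    _∙_ : Tm n → Tm n → Tm n

  infix 4 _⊢_⇓_
  data _⊢_⇓_ {n} (ρ : Vec A n) : Tm n → A → Set where
    var⇓ : ∀ x → ρ ⊢ var x ⇓ lookup ρ x
    con⇓ : ∀ {a a∈} → ρ ⊢ con a a∈ ⇓ a
    app⇓ : ∀ {t u f a v} → ρ ⊢ t ⇓ f → ρ ⊢ u ⇓ a → f · a ↝ v → ρ ⊢ t ∙ u ⇓ v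

  ⇓-A′ : ∀ {n} {ρ : Vec A n} {t v} → (∀ x → A′ (lookup ρ x)) → ρ ⊢ t ⇓ v → A′ v
  ⇓-A′ ρ∈ (var⇓ x)          = ρ∈ x
  ⇓-A′ ρ∈ (con⇓ {a∈ = a∈})  = a∈
  ⇓-A′ ρ∈ (app⇓ t⇓ u⇓ fa↝v) = ·-clos (⇓-A′ ρ∈ t⇓) (⇓-A′ ρ∈ u⇓) fa↝v

  closed-⇓-A′ : ∀ {t v} → [] ⊢ t ⇓ v → A′ v
  closed-⇓-A′ = ⇓-A′ (λ ())

  constant : ∀ {ℓ} {Q : A → Set ℓ} {n} → Σ A (λ r → A′ r × Q r) → Tm n
  constant (r , r∈ , _) = con r r∈

  K S I : ∀ {n} → Tm n
  K = con k k∈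
  S = con s s∈
  I = S ∙ K ∙ K

  PAIR : ∀ {n} → Tm n → Tm n → Tm n
  PAIR t u = S ∙ (S ∙ I ∙ (K ∙ t)) ∙ (K ∙ u)

  N1 : ∀ {n} → Tm n
  N1 = PAIR (K ∙ I) I

  FST SND : ∀ {n} → Tm n → Tm n
  FST t = t ∙ K
  SND t = t ∙ (K ∙ I)

  IF : ∀ {n} → Tm n → Tm n → Tm n → Tm n
  IF t u w = t ∙ K ∙ u ∙ w

  module _ {n} {ρ : Vec A n} where

    I⇓ : ρ ⊢ I ⇓ i 𝔸
    I⇓ = app⇓ (app⇓ con⇓ con⇓ (s-ax₁ k)) con⇓ (s-ax₂ k k)

    PAIR⇓ : ∀ {t u a b} → ρ ⊢ t ⇓ a → ρ ⊢ u ⇓ b → ρ ⊢ PAIR t u ⇓ pair 𝔸 a b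
    PAIR⇓ {a = a} {b} t⇓ u⇓ =
      app⇓ (app⇓ con⇓ (app⇓ (app⇓ con⇓ I⇓ (s-ax₁ _)) (app⇓ con⇓ t⇓ (k-ax₁ a)) (s-ax₂ _ _)) (s-ax₁ _))
           (app⇓ con⇓ u⇓ (k-ax₁ b)) (s-ax₂ _ _)

    N1⇓ : ρ ⊢ N1 ⇓ n1 𝔸
    N1⇓ = PAIR⇓ (app⇓ con⇓ I⇓ (k-ax₁ _)) I⇓

    FST⇓ : ∀ {t a b} → ρ ⊢ t ⇓ pair 𝔸 a b → ρ ⊢ FST t ⇓ a
    FST⇓ t⇓ = app⇓ t⇓ con⇓ (pair-·-k _ _)

    SND⇓ : ∀ {t a b} → ρ ⊢ t ⇓ pair 𝔸 a b → ρ ⊢ SND t ⇓ b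
    SND⇓ t⇓ = app⇓ t⇓ (app⇓ con⇓ I⇓ (k-ax₁ _)) (pair-·-k₁i _ _)

    IF⇓-n0 : ∀ {t u w a b} → ρ ⊢ t ⇓ n0 𝔸 → ρ ⊢ u ⇓ a → ρ ⊢ w ⇓ b → ρ ⊢ IF t u w ⇓ a
    IF⇓-n0 {a = a} {b} t⇓ u⇓ w⇓ = app⇓ (app⇓ (app⇓ t⇓ con⇓ (i-· k)) u⇓ (k-ax₁ a)) w⇓ (k-ax₂ a b)

    IF⇓-n1 : ∀ {t u w a b} → ρ ⊢ t ⇓ n1 𝔸 → ρ ⊢ u ⇓ a → ρ ⊢ w ⇓ b → ρ ⊢ IF t u w ⇓ b
    IF⇓-n1 {a = a} {b} t⇓ u⇓ w⇓ =
      app⇓ (app⇓ (app⇓ t⇓ con⇓ (pair-·-k _ _)) u⇓ (k-ax₂ (i 𝔸) a)) w⇓ (i-· b)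

  infix 9 ƛ_
  ƛ_ : ∀ {n} → Tm (suc n) → Tm n
  ƛ var zero    = I
  ƛ var (suc x) = K ∙ var x
  ƛ con a a∈    = K ∙ con a a∈
  ƛ (t ∙ u)     = S ∙ ƛ t ∙ ƛ u

  ƛ⇓ : ∀ {n} (ρ : Vec A n) t → Σ A λ g → ρ ⊢ ƛ t ⇓ g × (∀ a v → a ∷ ρ ⊢ t ⇓ v → g · a ↝ v)
  ƛ⇓ ρ (var zero)    = i 𝔸 , I⇓ , λ { a _ (var⇓ zero) → i-· a }
  ƛ⇓ ρ (var (suc x)) = k₁ (lookup ρ x) , app⇓ con⇓ (var⇓ x) (k-ax₁ _) , λ { a _ (var⇓ _) → k-ax₂ _ a }
  ƛ⇓ ρ (con c c∈)    = k₁ c , app⇓ con⇓ con⇓ (k-ax₁ c) , λ { a _ con⇓ → k-ax₂ c a }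
  ƛ⇓ ρ (t ∙ u) with ƛ⇓ ρ t | ƛ⇓ ρ u
  ... | g , g⇓ , g-β | h , h⇓ , h-β =
    s₂ g h , app⇓ (app⇓ con⇓ g⇓ (s-ax₁ g)) h⇓ (s-ax₂ g h) ,
    λ { a _ (app⇓ t⇓ u⇓ fa↝v) → s₂-· (g-β a _ t⇓) (h-β a _ u⇓) fa↝v }

  infixl 8 _[_]
  _[_] : ∀ {n m} → Tm n → (Fin n → Tm m) → Tm m
  var x    [ σ ] = σ x
  con a a∈ [ σ ] = con a a∈
  (t ∙ u)  [ σ ] = t [ σ ] ∙ u [ σ ]

  []⇓ : ∀ {n m} {ρ : Vec A n} {ρ′ : Vec A m} {σ : Fin n → Tm m} {t v} →
        (∀ x → ρ′ ⊢ σ x ⇓ lookup ρ x) → ρ ⊢ t ⇓ v → ρ′ ⊢ t [ σ ] ⇓ v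
  []⇓ σ⇓ (var⇓ x)          = σ⇓ x
  []⇓ σ⇓ con⇓              = con⇓
  []⇓ σ⇓ (app⇓ t⇓ u⇓ fa↝v) = app⇓ ([]⇓ σ⇓ t⇓) ([]⇓ σ⇓ u⇓) fa↝v

  selfApply : Fin 2 → Tm 2
  selfApply zero       = var zero
  selfApply (suc zero) = var (suc zero) ∙ var (suc zero)

  -- Recursion theorem: var 1 in t denotes the realizer being defined.
  -- It is g · g for g := λf.λx. t[f ↦ f f].
  fix : (t : Tm 2) → Σ A λ e → A′ e × (∀ {a v} → a ∷ e ∷ [] ⊢ t ⇓ v → e · a ↝ v)
  fix t with ƛ⇓ [] (ƛ (t [ selfApply ]))
  ... | g , g⇓ , g-β with ƛ⇓ (g ∷ []) (t [ selfApply ])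
  ...   | e , e⇓ , e-β = e , closed-⇓-A′ (app⇓ g⇓ g⇓ gg↝e) , λ t⇓ → e-β _ _ ([]⇓ selfApply⇓ t⇓)
    where
      gg↝e : g · g ↝ e
      gg↝e = g-β g e e⇓

      selfApply⇓ : ∀ {a} x → a ∷ g ∷ [] ⊢ selfApply x ⇓ lookup (a ∷ e ∷ []) x
      selfApply⇓ zero       = var⇓ zero
      selfApply⇓ (suc zero) = app⇓ (var⇓ (# 1)) (var⇓ (# 1)) gg↝e

module _ (𝔸 : PCA) (𝔸′ : ElemSub 𝔸) where
  open PCA 𝔸

  ≃ᴶ-congʳ : ∀ {ℓ ℓ′ ℓ″} {J : Pow 𝔸 → A → Set ℓ} {K : Pow 𝔸 → A → Set ℓ′} {L : Pow 𝔸 → A → Set ℓ″} →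
             (∀ {S a} → K S a → L S a) → (∀ {S a} → L S a → K S a) →
             _≃ᴶ_ 𝔸 𝔸′ J K → _≃ᴶ_ 𝔸 𝔸′ J L
  ≃ᴶ-congʳ K⊆L L⊆K ((r , r∈ , J→K) , (r′ , r′∈ , K→J)) =
    (r , r∈ , λ S a Ja → map₂ (map₂ K⊆L) (J→K S a Ja)) , (r′ , r′∈ , λ S a La → K→J S a (L⊆K La))

module Instances (𝔸 : PCA) where
  open PCA 𝔸

  Instance : EWeihrauch 𝔸 → Set₁
  Instance f = Σ A λ b → Σ (Pow 𝔸) (f b)

  realizer : ∀ {f} → Instance f → A
  realizer = proj₁

  question : ∀ {f} → Instance f → Pow 𝔸
  question x = proj₁ (proj₂ x)

  O-Instance⇒O-EW : ∀ {f S o} → O-PA 𝔸 (Instance f) realizer question S o → O-EW 𝔸 f S o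
  O-Instance⇒O-EW (ret Sa) = ret Sa
  O-Instance⇒O-EW (ask (b , θ , fbθ) c h) =
    ask b θ fbθ c λ d θd → let (o , cd↝o , Oo) = h d θd in o , cd↝o , O-Instance⇒O-EW Oo

  O-EW⇒O-Instance : ∀ {f S o} → O-EW 𝔸 f S o → O-PA 𝔸 (Instance f) realizer question S o
  O-EW⇒O-Instance (ret Sa) = ret Sa
  O-EW⇒O-Instance (ask b θ fbθ c h) =
    ask (b , θ , fbθ) c λ d θd → let (o , cd↝o , Oo) = h d θd in o , cd↝o , O-EW⇒O-Instance Oo

module TopologyAsDialogues (𝔸 : PCA) (𝔸′ : ElemSub 𝔸) (J : Pow 𝔸 → Pow 𝔸) (top : IsTopology 𝔸 𝔸′ J) where
  open PCA 𝔸
  open ElemSub 𝔸′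
  open IsTopology top
  open Terms 𝔸 𝔸′
  open Instances 𝔸

  asEWeihrauch : EWeihrauch 𝔸
  asEWeihrauch b θ = J θ b

  O : Pow 𝔸 → A → Set₁
  O = O-PA 𝔸 (Instance asEWeihrauch) realizer question

  QUERY : Tm 1
  QUERY = PAIR N1 (PAIR (var zero) (ƛ PAIR I (var zero)))

  J⇒O : Σ A λ r → A′ r × (∀ S a → J S a → _·_∈_ 𝔸 r a (O S))
  J⇒O with ƛ⇓ [] QUERY
  ... | q , q⇓ , q-β = q , closed-⇓-A′ q⇓ , query
    where
      query : ∀ S a → J S a → _·_∈_ 𝔸 q a (O S)
      query S a Ja with ƛ⇓ (a ∷ []) (PAIR I (var zero))
      ... | r , r⇓ , r-β =
        _ , q-β a _ (PAIR⇓ N1⇓ (PAIR⇓ (var⇓ zero) r⇓)) ,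
        ask (a , S , Ja) r λ d Sd → _ , r-β d _ (PAIR⇓ I⇓ (var⇓ zero)) , ret Sd

  -- Variables: the query d, ⟨a, c⟩, the dialogue, the evaluator.
  RECURSE : Tm 4
  RECURSE = var (# 3) ∙ (SND (var (# 1)) ∙ var zero)

  ANSWER : Tm 3
  ANSWER = constant mult ∙ (constant mono ∙ ƛ RECURSE ∙ FST (var zero))

  EVAL : Tm 2
  EVAL = IF (FST (var zero)) (constant unit) (ƛ ANSWER) ∙ SND (var zero)

  RECURSE-realizes : ∀ {self a c o p S} → (_⇒_ 𝔸 𝔸′ p λ o′ → _·_∈_ 𝔸 self o′ (J S)) c →
                     Σ A λ ℓ → pair 𝔸 a c ∷ o ∷ self ∷ [] ⊢ ƛ RECURSE ⇓ ℓ × _⇒_ 𝔸 𝔸′ p (J S) ℓ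
  RECURSE-realizes {self} {a} {c} {o} c-eval with ƛ⇓ (pair 𝔸 a c ∷ o ∷ self ∷ []) RECURSE
  ... | ℓ , ℓ⇓ , ℓ-β = ℓ , ℓ⇓ , λ d pd →
    let (o′ , cd↝o′ , u , self·o′↝u , Ju) = c-eval d pd
    in u , ℓ-β d u (app⇓ (var⇓ (# 3)) (app⇓ (SND⇓ (var⇓ (# 1))) (var⇓ zero) cd↝o′) self·o′↝u) , Ju

  EVAL-ret : ∀ {self a S} → S a → Σ A λ v → pair 𝔸 (n0 𝔸) a ∷ self ∷ [] ⊢ EVAL ⇓ v × J S v
  EVAL-ret {self} {a} {S} Sa with proj₂ (proj₂ unit) S a Sa | ƛ⇓ (pair 𝔸 (n0 𝔸) a ∷ self ∷ []) ANSWER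
  ... | v , ua↝v , Jv | _ , answer⇓ , _ =
    v , app⇓ (IF⇓-n0 (FST⇓ (var⇓ zero)) con⇓ answer⇓) (SND⇓ (var⇓ zero)) ua↝v , Jv

  EVAL-ask : ∀ {self a c p S} → J p a → (_⇒_ 𝔸 𝔸′ p λ o → _·_∈_ 𝔸 self o (J S)) c →
             Σ A λ v → pair 𝔸 (n1 𝔸) (pair 𝔸 a c) ∷ self ∷ [] ⊢ EVAL ⇓ v × J S v
  EVAL-ask {self} {a} {c} {p} {S} Jpa c-eval
    with ƛ⇓ (pair 𝔸 (n1 𝔸) (pair 𝔸 a c) ∷ self ∷ []) ANSWER | RECURSE-realizes c-eval
  ... | _ , answer⇓ , answer-β | ℓ , ℓ⇓ , ℓ-realizes
    with proj₂ (proj₂ mono) p (J S) ℓ ℓ-realizes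
  ... | m , mono·ℓ↝m , m-realizes
    with m-realizes a Jpa
  ... | w , ma↝w , JJw
    with proj₂ (proj₂ mult) S w JJw
  ... | v , mult·w↝v , Jv =
    v ,
    app⇓ (IF⇓-n1 (FST⇓ (var⇓ zero)) con⇓ answer⇓) (SND⇓ (var⇓ zero))
         (answer-β _ v (app⇓ con⇓ (app⇓ (app⇓ con⇓ ℓ⇓ mono·ℓ↝m) (FST⇓ (var⇓ zero)) ma↝w) mult·w↝v)) ,
    Jv

  evaluator : Σ A λ e → A′ e × (∀ {o v} → o ∷ e ∷ [] ⊢ EVAL ⇓ v → e · o ↝ v)
  evaluator = fix EVAL

  evaluate : ∀ {S o} → O S o → _·_∈_ 𝔸 (proj₁ evaluator) o (J S)
  evaluate (ret Sa) = map₂ (map₁ (proj₂ (proj₂ evaluator))) (EVAL-ret Sa)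
  evaluate (ask (a , p , Jpa) c h) =
    map₂ (map₁ (proj₂ (proj₂ evaluator)))
         (EVAL-ask Jpa λ d pd → let (o , cd↝o , Oo) = h d pd in o , cd↝o , evaluate Oo)

  J≃O : _≃ᴶ_ 𝔸 𝔸′ J O
  J≃O = J⇒O , (proj₁ evaluator , proj₁ (proj₂ evaluator) , λ S o → evaluate)

theorem41 : (𝔸 : PCA) (𝔸′ : ElemSub 𝔸) (J : Pow 𝔸 → Pow 𝔸) →
    IsTopology 𝔸 𝔸′ J →
    (Σ Set₁ λ X → Σ (X → PCA.A 𝔸) λ ρ → Σ (X → Pow 𝔸) λ P →
       _≃ᴶ_ 𝔸 𝔸′ J (O-PA 𝔸 X ρ P))
    × (Σ (EWeihrauch 𝔸) λ f → _≃ᴶ_ 𝔸 𝔸′ J (O-EW 𝔸 f))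
theorem41 𝔸 𝔸′ J top =
  (Instance asEWeihrauch , realizer , question , J≃O) ,
  (asEWeihrauch , ≃ᴶ-congʳ 𝔸 𝔸′ O-Instance⇒O-EW O-EW⇒O-Instance J≃O)
  where
    open Instances 𝔸
    open TopologyAsDialogues 𝔸 𝔸′ J top
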